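{- Let $G$ be a finite non-trivial group such that the power graph $\mathcal{G}(G)$ is minimally edge-connected, and let $\delta$ denote the minimum degree of $\mathcal{G}(G)$. (i) If $x\in G$ has order $\mathrm{o}(x)>2$, then the degree of $x$ in $\mathcal{G}(G)$ equals $\delta$. (ii) If $\langle y\rangle$ is a maximal cyclic subgroup of $G$ and $\mathrm{o}(y)>2$, then $\mathrm{o}(y)=\delta+1$.
   Context: The power graph $\mathcal{G}(G)$ of a group $G$ is the simple undirected graph with vertex set $G$ in which two distinct vertices $u,v$ are adjacent if and only if $v=u^n$ for some positive integer $n$ or $u=v^m$ for some positive integer $m$. A non-trivial connected graph $\Gamma$ is minimally edge-connected if $\kappa'(\Gamma-\varepsilon)=\kappa'(\Gamma)-1$ for every edge $\varepsilon$, where $\kappa'$ denotes edge-connectivity. A maximal cyclic subgroup is a cyclic subgroup not properly contained in any other cyclic subgroup. -}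

module Defs where

open import Data.Nat using (ℕ; zero; suc; _≤_; _<_; _∸_)
open import Data.Fin using (Fin)
open import Data.Product using (Σ; _×_; _,_; proj₁; proj₂; ∃)
open import Data.Sum using (_⊎_)
open import Data.List using (List; []; _∷_; length)
open import Data.List.Membership.Propositional using (_∈_)
open import Data.List.Relation.Unary.Unique.Propositional using (Unique)
open import Relation.Nullary using (¬_)
open import Relation.Binary.PropositionalEquality using (_≡_; _≢_)
open import Relation.Binary.Construct.Closure.ReflexiveTransitive using (Star)
open import Function.Bundles using (_⇔_)
open import Algebra.Structures using (IsGroup)

-- Finite groups: carrier Fin n (every finite group is isomorphic to one
-- of these), with propositional equality.

record FiniteGroup : Set₁ where
  field
    n       : ℕ
    _∙_     : Fin n → Fin n → Fin n
    ε       : Fin n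
    _⁻¹     : Fin n → Fin n
    isGroup : IsGroup _≡_ _∙_ ε _⁻¹

  pow : Fin n → ℕ → Fin n
  pow x zero    = ε
  pow x (suc k) = x ∙ pow x k

  Order : Fin n → ℕ → Set
  Order x m = 1 ≤ m × pow x m ≡ ε × (∀ k → 1 ≤ k → k < m → pow x k ≢ ε)

  -- membership in the cyclic subgroup ⟨y⟩ (finite group: ℕ-powers suffice)
  InCyc : Fin n → Fin n → Set
  InCyc y z = ∃ λ k → z ≡ pow y k

  MaximalCyclic : Fin n → Set
  MaximalCyclic y = ∀ z → (∀ w → InCyc y w → InCyc z w) → (∀ w → InCyc z w → InCyc y w)

  PowerAdj : Fin n → Fin n → Set
  PowerAdj u v = u ≢ v × ((Σ ℕ λ k → 1 ≤ k × v ≡ pow u k) ⊎ (Σ ℕ λ m → 1 ≤ m × u ≡ pow v m))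

-- Simple graphs on Fin n, given by an (irreflexive, symmetric) adjacency relation.

module _ {n : ℕ} where

  Graph : Set₁
  Graph = Fin n → Fin n → Set

  Degree : Graph → Fin n → ℕ → Set
  Degree E x d = Σ (List (Fin n)) λ l →
    Unique l × length l ≡ d × (∀ v → (v ∈ l) ⇔ E x v)

  MinDegree : Graph → ℕ → Set
  MinDegree E δ = (∃ λ x → Degree E x δ) × (∀ x d → Degree E x d → δ ≤ d)

  RemoveEdges : Graph → List (Fin n × Fin n) → Graph
  RemoveEdges E F u v = E u v × ¬ ((u , v) ∈ F) × ¬ ((v , u) ∈ F)

  Connected : Graph → Set
  Connected E = ∀ u v → Star E u v

  EdgeConnectivity : Graph → ℕ → Set
  EdgeConnectivity E k =
    (Σ (List (Fin n × Fin n)) λ F → length F ≡ k × ¬ Connected (RemoveEdges E F))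
    × (∀ (F : List (Fin n × Fin n)) → length F < k → Connected (RemoveEdges E F))

  MinimallyEdgeConnected : Graph → Set
  MinimallyEdgeConnected E =
    2 ≤ n × Connected E ×
    (∀ u v → E u v → ∀ k → EdgeConnectivity E k →
       EdgeConnectivity (RemoveEdges E ((u , v) ∷ [])) (k ∸ 1))

-- If o(x) > 2 then y = x⁻¹ ≠ x is adjacent to x, and every other neighbour of x is also a
-- neighbour of y. Let κ' ≤ δ be the edge connectivity; by minimality some set F of κ' − 1
-- edges disconnects 𝒢(G) − xy. Charge each edge of F to one endpoint, avoiding x and y when
-- possible. If deg x > κ', some neighbour w ≠ y of x is uncharged, so the path x–w–y survives
-- in 𝒢(G) − xy − F and replaces xy; as 𝒢(G) − F is connected, so is 𝒢(G) − xy − F, a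
-- contradiction. Hence δ ≤ deg x ≤ κ' ≤ δ. For (ii), maximality of ⟨y⟩ makes the closed
-- neighbourhood of y equal to ⟨y⟩, so o(y) = deg y + 1 = δ + 1.

module Submission where

open import Defs
open import Data.Nat using (ℕ; zero; suc; _+_; _*_; _∸_; _≤_; _<_; z≤n; s≤s; _≤?_; NonZero)
open import Data.Nat.Properties
open import Data.Nat.DivMod using (_%_; _/_; m≡m%n+[m/n]*n; m%n<n)
open import Data.Nat.Induction using (<-rec)
open import Data.Nat.Tactic.RingSolver using (solve-∀)
open import Data.Fin using (Fin; toℕ; fromℕ<)
open import Data.Fin.Properties using (any?; all?; ¬∀⟶∃¬; pigeonhole; toℕ-fromℕ<; toℕ-injective; toℕ<n)
  renaming (_≟_ to _≟ᶠ_)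
open import Data.Product using (∃; _×_; _,_; proj₁; proj₂)
open import Data.Product.Properties using (≡-dec)
open import Data.Sum using (_⊎_; inj₁; inj₂)
open import Data.Empty using (⊥-elim)
open import Data.List using (List; []; _∷_; length; allFin; filter; map; tabulate)
open import Data.List.Properties using (length-removeAt′; length-filter; length-tabulate; length-map)
open import Data.List.Membership.Propositional using (_∈_; _∉_; find)
open import Data.List.Membership.Propositional.Properties
  using (∈-allFin; ∈-filter⁺; ∈-filter⁻; ∈-map⁺; ∈-tabulate⁺; ∈-tabulate⁻)
import Data.List.Membership.DecPropositional as DecMembership
open import Data.List.Relation.Unary.Any using (here; there; index; _─_)
open import Data.List.Relation.Unary.All as All using (All; []; _∷_)
open import Data.List.Relation.Unary.All.Properties using (¬All⇒Any¬)
open import Data.List.Relation.Unary.AllPairs using ([]; _∷_)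
open import Data.List.Relation.Unary.Unique.Propositional using (Unique)
import Data.List.Relation.Unary.Unique.Propositional.Properties as Unique
open import Data.List.Relation.Binary.Subset.Propositional using (_⊆_)
open import Relation.Nullary using (¬_; Dec; yes; no)
open import Relation.Nullary.Decidable using (_×-dec_; _⊎-dec_; _→-dec_; ¬?; decidable-stable)
open import Relation.Binary.Definitions using (Decidable; Symmetric; Irreflexive; tri<; tri≈; tri>)
open import Relation.Binary.PropositionalEquality
  using (_≡_; _≢_; refl; sym; trans; cong; subst; module ≡-Reasoning)
open import Relation.Binary.Construct.Closure.ReflexiveTransitive
  using (Star; _◅_; _◅◅_; _⋆; return) renaming (ε to nil)
open import Function using (_∘_)
open import Function.Bundles using (Equivalence; mk⇔)
open import Algebra.Bundles using (Group)
open import Algebra.Structures using (IsGroup)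
import Algebra.Properties.Group as GroupProperties

module _ {a} {A : Set a} where

  ∈-─⁺ : ∀ {x z} {xs : List A} (x∈xs : x ∈ xs) → z ∈ xs → z ≢ x → z ∈ (xs ─ x∈xs)
  ∈-─⁺ (here refl)  (here refl)  z≢x = ⊥-elim (z≢x refl)
  ∈-─⁺ (here refl)  (there z∈xs) _   = z∈xs
  ∈-─⁺ (there x∈xs) (here refl)  _   = here refl
  ∈-─⁺ (there x∈xs) (there z∈xs) z≢x = there (∈-─⁺ x∈xs z∈xs z≢x)

  unique-⊆⇒length≤ : ∀ {xs ys : List A} → Unique xs → xs ⊆ ys → length xs ≤ length ys
  unique-⊆⇒length≤ {[]}     _               _        = z≤n
  unique-⊆⇒length≤ {x ∷ xs} {ys} (x∉xs ∷ uxs) x∷xs⊆ys =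
    ≤-trans (s≤s (unique-⊆⇒length≤ uxs xs⊆ys─x)) (≤-reflexive (sym (length-removeAt′ ys (index x∈ys))))
    where
    x∈ys : x ∈ ys
    x∈ys = x∷xs⊆ys (here refl)
    xs⊆ys─x : xs ⊆ (ys ─ x∈ys)
    xs⊆ys─x z∈xs = ∈-─⁺ x∈ys (x∷xs⊆ys (there z∈xs)) λ { refl → All.lookup x∉xs z∈xs refl }

  unique-⊆-⊇⇒length≡ : ∀ {xs ys : List A} → Unique xs → Unique ys → xs ⊆ ys → ys ⊆ xs →
                        length xs ≡ length ys
  unique-⊆-⊇⇒length≡ uxs uys xs⊆ys ys⊆xs =
    ≤-antisym (unique-⊆⇒length≤ uxs xs⊆ys) (unique-⊆⇒length≤ uys ys⊆xs)

module FiniteReachability {m : ℕ} {R : Fin m → Fin m → Set} (R? : Decidable R) (u : Fin m) where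

  Within : ℕ → Fin m → Set
  Within zero    v = u ≡ v
  Within (suc j) v = Within j v ⊎ ∃ λ w → Within j w × R w v

  within? : ∀ j v → Dec (Within j v)
  within? zero    v = u ≟ᶠ v
  within? (suc j) v = within? j v ⊎-dec any? λ w → within? j w ×-dec R? w v

  within-start : ∀ j → Within j u
  within-start zero    = refl
  within-start (suc j) = inj₁ (within-start j)

  within⇒Star : ∀ j {v} → Within j v → Star R u v
  within⇒Star zero    refl               = nil
  within⇒Star (suc j) (inj₁ r)           = within⇒Star j r
  within⇒Star (suc j) (inj₂ (w , r , e)) = within⇒Star j r ◅◅ return e

  Saturated : ℕ → Set
  Saturated j = ∀ v → Within (suc j) v → Within j v

  saturated? : ∀ j → Dec (Saturated j)
  saturated? j = all? λ v → within? (suc j) v →-dec within? j v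

  saturated-suc : ∀ {j} → Saturated j → Saturated (suc j)
  saturated-suc sat v (inj₁ r)           = r
  saturated-suc sat v (inj₂ (w , r , e)) = inj₂ (w , sat w r , e)

  newVertex : ∀ {j} → ¬ Saturated j → ∃ λ v → Within (suc j) v × ¬ Within j v
  newVertex {j} ¬sat with ¬∀⟶∃¬ m _ (λ v → within? (suc j) v →-dec within? j v) ¬sat
  ... | v , ¬step with within? (suc j) v | within? j v
  ...   | yes new | no old = v , new , old
  ...   | _       | yes r  = ⊥-elim (¬step λ _ → r)
  ...   | no ¬new | no _   = ⊥-elim (¬step λ new → ⊥-elim (¬new new))

  ball : ℕ → List (Fin m)
  ball j = filter (within? j) (allFin m)

  ball-grows : ∀ {j v} → Within (suc j) v → ¬ Within j v → length (ball j) < length (ball (suc j))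
  ball-grows {j} {v} new old =
    unique-⊆⇒length≤ (All.tabulate v∉ball ∷ Unique.filter⁺ (within? j) (Unique.allFin⁺ m)) v∷ball⊆ball
    where
    v∉ball : ∀ {z} → z ∈ ball j → v ≢ z
    v∉ball z∈ball refl = old (proj₂ (∈-filter⁻ (within? j) {xs = allFin m} z∈ball))
    v∷ball⊆ball : v ∷ ball j ⊆ ball (suc j)
    v∷ball⊆ball (here refl)    = ∈-filter⁺ (within? (suc j)) (∈-allFin v) new
    v∷ball⊆ball (there z∈ball) =
      ∈-filter⁺ (within? (suc j)) (∈-allFin _) (inj₁ (proj₂ (∈-filter⁻ (within? j) {xs = allFin m} z∈ball)))

  saturated⊎grows : ∀ j → Saturated j ⊎ j < length (ball j)
  saturated⊎grows zero =
    inj₂ (unique-⊆⇒length≤ ([] ∷ []) λ { (here refl) → ∈-filter⁺ (within? 0) (∈-allFin u) refl })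
  saturated⊎grows (suc j) with saturated? j | saturated⊎grows j
  ... | yes sat | _        = inj₁ (saturated-suc sat)
  ... | no ¬sat | inj₁ sat = ⊥-elim (¬sat sat)
  ... | no ¬sat | inj₂ grows with newVertex ¬sat
  ...   | _ , new , old = inj₂ (≤-trans (s≤s grows) (ball-grows new old))

  -- The balls cannot keep growing, as none has more than m vertices.
  saturated-at-size : Saturated m
  saturated-at-size with saturated⊎grows m
  ... | inj₁ sat   = sat
  ... | inj₂ grows =
    ⊥-elim (<⇒≱ grows (≤-trans (length-filter (within? m) (allFin m))
                               (≤-reflexive (length-tabulate (λ i → i)))))

  Star⇒within : ∀ {a v} → Within m a → Star R a v → Within m v
  Star⇒within r nil     = r
  Star⇒within r (e ◅ s) = Star⇒within (saturated-at-size _ (inj₂ (_ , r , e))) s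

  reachable? : ∀ v → Dec (Star R u v)
  reachable? v with within? m v
  ... | yes r = yes (within⇒Star m r)
  ... | no ¬r = no λ s → ¬r (Star⇒within (within-start m) s)

Star? : ∀ {m} {R : Fin m → Fin m → Set} → Decidable R → Decidable (Star R)
Star? R? u = FiniteReachability.reachable? R? u

Connected? : ∀ {n} {E : Graph {n}} → Decidable E → Dec (Connected E)
Connected? E? = all? λ u → all? λ v → Star? E? u v

∃-≢ : ∀ {n} → 2 ≤ n → (x : Fin n) → ∃ λ v → x ≢ v
∃-≢ (s≤s (s≤s _)) Fin.zero    = Fin.suc Fin.zero , λ ()
∃-≢ (s≤s (s≤s _)) (Fin.suc _) = Fin.zero , λ ()

∉-[_] : ∀ {a} {A : Set a} {p q : A} → p ≢ q → p ∉ q ∷ []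
∉-[ p≢q ] (here p≡q) = p≢q p≡q

module _ {n : ℕ} where

  open DecMembership (≡-dec (_≟ᶠ_ {n}) (_≟ᶠ_ {n})) using (_∈?_)

  Disconnecting : Graph {n} → ℕ → Set
  Disconnecting E j = ∃ λ F → length F ≡ j × ¬ Connected (RemoveEdges E F)

  RemoveEdges? : ∀ {E : Graph {n}} → Decidable E → ∀ F → Decidable (RemoveEdges E F)
  RemoveEdges? E? F a b = E? a b ×-dec ¬? ((a , b) ∈? F) ×-dec ¬? ((b , a) ∈? F)

  RemoveEdges-sym : ∀ {E : Graph {n}} {F} → Symmetric E → Symmetric (RemoveEdges E F)
  RemoveEdges-sym E-sym (e , ab∉F , ba∉F) = E-sym e , ba∉F , ab∉F

  RemoveEdges-[] : ∀ {E : Graph {n}} → Connected E → Connected (RemoveEdges E [])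
  RemoveEdges-[] conn u v = ((λ e → return (e , (λ ()) , (λ ()))) ⋆) (conn u v)

  neighbours : ∀ {E : Graph {n}} → Decidable E → Fin n → List (Fin n)
  neighbours E? x = filter (E? x) (allFin n)

  degree-neighbours : ∀ {E : Graph {n}} (E? : Decidable E) x → Degree E x (length (neighbours E? x))
  degree-neighbours E? x =
    neighbours E? x , Unique.filter⁺ (E? x) (Unique.allFin⁺ n) , refl ,
    λ v → mk⇔ (λ v∈ → proj₂ (∈-filter⁻ (E? x) {xs = allFin n} v∈)) (∈-filter⁺ (E? x) (∈-allFin v))

  -- Deleting all edges at a vertex isolates it.
  degree⇒disconnecting : ∀ {E : Graph {n}} {x d} → 2 ≤ n → Degree E x d → Disconnecting E d
  degree⇒disconnecting {E} {x} 2≤n (L , _ , |L|≡d , L⇔) =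
    map (x ,_) L , trans (length-map _ L) |L|≡d , isolated
    where
    isolated : ¬ Connected (RemoveEdges E (map (x ,_) L))
    isolated conn with ∃-≢ 2≤n x
    ... | v , x≢v with conn x v
    ...   | nil = x≢v refl
    ...   | _◅_ {j = w} (x~w , xw∉F , _) _ = xw∉F (∈-map⁺ (x ,_) (Equivalence.from (L⇔ w) x~w))

  -- Only up to double negation: the minimality clause of κ' needs stability of connectivity,
  -- which its decidability provides.
  ¬¬edgeConnectivity≤ : ∀ {E : Graph {n}} → Decidable E → ∀ j → Disconnecting E j →
                        ¬ ¬ (∃ λ k → k ≤ j × EdgeConnectivity E k)
  ¬¬edgeConnectivity≤ {E} E? = <-rec _ step
    where
    step : ∀ j → (∀ {i} → i < j → Disconnecting E i → ¬ ¬ (∃ λ k → k ≤ i × EdgeConnectivity E k)) →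
           Disconnecting E j → ¬ ¬ (∃ λ k → k ≤ j × EdgeConnectivity E k)
    step j ih disconnecting ¬κ = ¬κ (j , ≤-refl , disconnecting , smaller-connected)
      where
      smaller-connected : ∀ F → length F < j → Connected (RemoveEdges E F)
      smaller-connected F |F|<j = decidable-stable (Connected? (RemoveEdges? E? F)) λ ¬conn →
        ih |F|<j (F , refl , ¬conn) λ (k , k≤|F| , κ) → ¬κ (k , ≤-trans k≤|F| (<⇒≤ |F|<j) , κ)

module TwinEdge {n : ℕ} {E : Graph {n}} (E-sym : Symmetric E) (E-irrefl : Irreflexive _≡_ E)
                {x y : Fin n} (x~y : E x y) (twin : ∀ {w} → w ≢ y → E x w → E y w)
                (F : List (Fin n × Fin n)) where

  open DecMembership (_≟ᶠ_ {n}) using (_∈?_)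

  E∖xy∖F : Graph {n}
  E∖xy∖F = RemoveEdges (RemoveEdges E ((x , y) ∷ [])) F

  charge : Fin n × Fin n → Fin n
  charge (a , b) with a ≟ᶠ x | a ≟ᶠ y
  ... | yes _ | _     = b
  ... | no _  | yes _ = b
  ... | no _  | no _  = a

  charge-x : ∀ b → charge (x , b) ≡ b
  charge-x b with x ≟ᶠ x
  ... | yes _  = refl
  ... | no x≢x = ⊥-elim (x≢x refl)

  charge-y : ∀ b → charge (y , b) ≡ b
  charge-y b with y ≟ᶠ x | y ≟ᶠ y
  ... | yes _ | _      = refl
  ... | no _  | yes _  = refl
  ... | no _  | no y≢y = ⊥-elim (y≢y refl)

  charge-other : ∀ {a} b → a ≢ x → a ≢ y → charge (a , b) ≡ a
  charge-other {a} b a≢x a≢y with a ≟ᶠ x | a ≟ᶠ y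
  ... | yes a≡x | _       = ⊥-elim (a≢x a≡x)
  ... | no _    | yes a≡y = ⊥-elim (a≢y a≡y)
  ... | no _    | no _    = refl

  charged : List (Fin n)
  charged = y ∷ map charge F

  -- An uncharged neighbour w of x lets x–w–y replace the deleted edge xy.
  module Bypass {w} (x~w : E x w) (w∉charged : w ∉ charged) where

    w≢x : w ≢ x
    w≢x w≡x = E-irrefl (sym w≡x) x~w

    w≢y : w ≢ y
    w≢y = w∉charged ∘ here

    y≢x : y ≢ x
    y≢x y≡x = E-irrefl (sym y≡x) x~y

    ∉F : ∀ {e} → charge e ≡ w → e ∉ F
    ∉F ce≡w e∈F = w∉charged (there (subst (_∈ map charge F) ce≡w (∈-map⁺ charge e∈F)))

    x~w′ : E∖xy∖F x w
    x~w′ = (x~w , ∉-[ w≢y ∘ cong proj₂ ] , ∉-[ w≢x ∘ cong proj₁ ]) ,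
           ∉F (charge-x w) , ∉F (charge-other x w≢x w≢y)

    y~w′ : E∖xy∖F y w
    y~w′ = (twin w≢y x~w , ∉-[ y≢x ∘ cong proj₁ ] , ∉-[ w≢x ∘ cong proj₁ ]) ,
           ∉F (charge-y w) , ∉F (charge-other y w≢x w≢y)

    E∖xy∖F-sym : Symmetric E∖xy∖F
    E∖xy∖F-sym = RemoveEdges-sym (RemoveEdges-sym E-sym)

    reroute : ∀ {a b} → RemoveEdges E F a b → Star E∖xy∖F a b
    reroute {a} {b} (a~b , ab∉F , ba∉F) with ≡-dec _≟ᶠ_ _≟ᶠ_ (a , b) (x , y)
    ... | yes refl = x~w′ ◅ E∖xy∖F-sym y~w′ ◅ nil
    ... | no ab≢xy with ≡-dec _≟ᶠ_ _≟ᶠ_ (b , a) (x , y)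
    ...   | yes refl = y~w′ ◅ E∖xy∖F-sym x~w′ ◅ nil
    ...   | no ba≢xy = return ((a~b , ∉-[ ab≢xy ] , ∉-[ ba≢xy ]) , ab∉F , ba∉F)

    connected : Connected (RemoveEdges E F) → Connected E∖xy∖F
    connected conn u v = (reroute ⋆) (conn u v)

  twinEdge-degree≤ : Connected (RemoveEdges E F) → ¬ Connected E∖xy∖F →
                     ∀ {d} → Degree E x d → d ≤ suc (length F)
  twinEdge-degree≤ conn ¬conn (L , uniqueL , refl , L⇔) with All.all? (_∈? charged) L
  ... | yes L⊆charged =
    ≤-trans (unique-⊆⇒length≤ uniqueL (All.lookup L⊆charged)) (≤-reflexive (cong suc (length-map charge F)))
  ... | no L⊈charged with find (¬All⇒Any¬ (_∈? charged) L L⊈charged)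
  ...   | w , w∈L , w∉charged = ⊥-elim (¬conn (Bypass.connected (Equivalence.to (L⇔ w) w∈L) w∉charged conn))

twin-degree≡minDegree : ∀ {n} {E : Graph {n}} → Decidable E → Symmetric E → Irreflexive _≡_ E →
                        MinimallyEdgeConnected E → ∀ {δ} → MinDegree E δ →
                        ∀ {x y} → E x y → (∀ {w} → w ≢ y → E x w → E y w) → Degree E x δ
twin-degree≡minDegree {E = E} E? E-sym E-irrefl (2≤n , conn , minimal) {δ} (minDeg , δ≤) {x} {y} x~y twin =
  subst (Degree E x) (≤-antisym d≤δ (δ≤ x d degree)) degree
  where
  d : ℕ
  d = length (neighbours E? x)

  degree : Degree E x d
  degree = degree-neighbours E? x

  d≤κ : ∀ {k} → EdgeConnectivity E k → d ≤ k
  d≤κ {zero}  (([] , _ , ¬conn) , _) = ⊥-elim (¬conn (RemoveEdges-[] conn))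
  d≤κ {suc k} κ@(_ , smaller-connected) with minimal x y x~y (suc k) κ
  ... | (F , refl , ¬conn) , _ =
    TwinEdge.twinEdge-degree≤ E-sym E-irrefl x~y twin F (smaller-connected F ≤-refl) ¬conn degree

  d≤δ : d ≤ δ
  d≤δ = decidable-stable (d ≤? δ) λ d≰δ →
    ¬¬edgeConnectivity≤ E? δ (degree⇒disconnecting 2≤n (proj₂ minDeg))
      λ (k , k≤δ , κ) → d≰δ (≤-trans (d≤κ κ) k≤δ)

module PowerGraph (G : FiniteGroup) where

  open FiniteGroup G
  open IsGroup isGroup using (assoc; identityˡ; identityʳ)

  group : Group _ _
  group = record { isGroup = isGroup }

  open GroupProperties group using (∙-cancelˡ)
  open ≡-Reasoning

  x∙y≡x⇒y≡ε : ∀ x y → x ∙ y ≡ x → y ≡ ε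
  x∙y≡x⇒y≡ε x y x∙y≡x = ∙-cancelˡ x y ε (trans x∙y≡x (sym (identityʳ x)))

  pow-+ : ∀ x a b → pow x (a + b) ≡ pow x a ∙ pow x b
  pow-+ x zero    b = sym (identityˡ _)
  pow-+ x (suc a) b = trans (cong (x ∙_) (pow-+ x a b)) (sym (assoc _ _ _))

  pow-* : ∀ x a b → pow (pow x a) b ≡ pow x (a * b)
  pow-* x a zero    = cong (pow x) (sym (*-zeroʳ a))
  pow-* x a (suc b) = begin
    pow x a ∙ pow (pow x a) b  ≡⟨ cong (pow x a ∙_) (pow-* x a b) ⟩
    pow x a ∙ pow x (a * b)    ≡⟨ sym (pow-+ x a (a * b)) ⟩
    pow x (a + a * b)          ≡⟨ cong (pow x) (sym (*-suc a b)) ⟩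
    pow x (a * suc b)          ∎

  pow-ε : ∀ b → pow ε b ≡ ε
  pow-ε zero    = refl
  pow-ε (suc b) = trans (identityˡ _) (pow-ε b)

  pow≡ε⇒pow-*≡ε : ∀ {x p} → pow x p ≡ ε → ∀ q → pow x (p * q) ≡ ε
  pow≡ε⇒pow-*≡ε {x} {p} xᵖ≡ε q = trans (sym (pow-* x p q)) (trans (cong (λ z → pow z q) xᵖ≡ε) (pow-ε q))

  pow-∸ : ∀ x {i j} → i ≤ j → pow x i ≡ pow x j → pow x (j ∸ i) ≡ ε
  pow-∸ x {i} {j} i≤j xⁱ≡xʲ = x∙y≡x⇒y≡ε (pow x i) (pow x (j ∸ i)) (begin
    pow x i ∙ pow x (j ∸ i)  ≡⟨ sym (pow-+ x i (j ∸ i)) ⟩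
    pow x (i + (j ∸ i))      ≡⟨ cong (pow x) (m+[n∸m]≡n i≤j) ⟩
    pow x j                  ≡⟨ sym xⁱ≡xʲ ⟩
    pow x i                  ∎)

  ∃pow≡ε : ∀ x → ∃ λ p → 1 ≤ p × pow x p ≡ ε
  ∃pow≡ε x with pigeonhole (n<1+n n) (λ (i : Fin (suc n)) → pow x (toℕ i))
  ... | i , j , i<j , xⁱ≡xʲ = toℕ j ∸ toℕ i , m<n⇒0<n∸m i<j , pow-∸ x (<⇒≤ i<j) xⁱ≡xʲ

  pow-% : ∀ x {p} .{{_ : NonZero p}} → pow x p ≡ ε → ∀ k → pow x k ≡ pow x (k % p)
  pow-% x {p} xᵖ≡ε k = begin
    pow x k                             ≡⟨ cong (pow x) (m≡m%n+[m/n]*n k p) ⟩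
    pow x (k % p + k / p * p)           ≡⟨ pow-+ x (k % p) (k / p * p) ⟩
    pow x (k % p) ∙ pow x (k / p * p)   ≡⟨ cong (λ e → pow x (k % p) ∙ pow x e) (*-comm (k / p) p) ⟩
    pow x (k % p) ∙ pow x (p * (k / p)) ≡⟨ cong (pow x (k % p) ∙_) (pow≡ε⇒pow-*≡ε {x} {p} xᵖ≡ε (k / p)) ⟩
    pow x (k % p) ∙ ε                   ≡⟨ identityʳ _ ⟩
    pow x (k % p)                       ∎

  PositivePower : Fin n → Fin n → Set
  PositivePower u v = ∃ λ k → 1 ≤ k × v ≡ pow u k

  positivePower? : Decidable PositivePower
  positivePower? u v with ∃pow≡ε u
  ... | p@(suc _) , _ , uᵖ≡ε with any? (λ (r : Fin p) → v ≟ᶠ pow u (suc (toℕ r)))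
  ...   | yes (r , v≡u¹⁺ʳ) = yes (suc (toℕ r) , s≤s z≤n , v≡u¹⁺ʳ)
  ...   | no ¬v≡u¹⁺ʳ = no λ where
    (suc k , _ , v≡u¹⁺ᵏ) → ¬v≡u¹⁺ʳ (fromℕ< (m%n<n k p) , (begin
      v                                    ≡⟨ v≡u¹⁺ᵏ ⟩
      u ∙ pow u k                          ≡⟨ cong (u ∙_) (pow-% u uᵖ≡ε k) ⟩
      u ∙ pow u (k % p)                    ≡⟨ cong (λ e → u ∙ pow u e) (sym (toℕ-fromℕ< (m%n<n k p))) ⟩
      u ∙ pow u (toℕ (fromℕ< (m%n<n k p))) ∎))

  PowerAdj? : Decidable PowerAdj
  PowerAdj? u v = ¬? (u ≟ᶠ v) ×-dec (positivePower? u v ⊎-dec positivePower? v u)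

  PowerAdj-sym : Symmetric PowerAdj
  PowerAdj-sym (u≢v , inj₁ v=uᵏ) = u≢v ∘ sym , inj₂ v=uᵏ
  PowerAdj-sym (u≢v , inj₂ u=vᵏ) = u≢v ∘ sym , inj₁ u=vᵏ

  PowerAdj-irrefl : Irreflexive _≡_ PowerAdj
  PowerAdj-irrefl u≡v (u≢v , _) = u≢v u≡v

  positivePower-trans : ∀ {u v w} → PositivePower u v → PositivePower v w → PositivePower u w
  positivePower-trans {u} (i , 1≤i , refl) (j , 1≤j , refl) = i * j , *-mono-≤ 1≤i 1≤j , pow-* u i j

  mutualPowers-PowerAdj : ∀ {a b w} → PositivePower a b → PositivePower b a →
                          a ≢ w → PowerAdj b w → PowerAdj a w
  mutualPowers-PowerAdj a→b b→a a≢w (_ , inj₁ b→w) = a≢w , inj₁ (positivePower-trans a→b b→w)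
  mutualPowers-PowerAdj a→b b→a a≢w (_ , inj₂ w→b) = a≢w , inj₂ (positivePower-trans w→b b→a)

  order-pow-distinct : ∀ {y m i j} → Order y m → i < j → j < m → pow y i ≢ pow y j
  order-pow-distinct {y} {i = i} {j} (_ , _ , minimal) i<j j<m yⁱ≡yʲ =
    minimal (j ∸ i) (m<n⇒0<n∸m i<j) (≤-<-trans (m∸n≤m j i) j<m) (pow-∸ y (<⇒≤ i<j) yⁱ≡yʲ)

  order-injective : ∀ {y m i j} → Order y m → i < m → j < m → pow y i ≡ pow y j → i ≡ j
  order-injective {i = i} {j} ord i<m j<m yⁱ≡yʲ with <-cmp i j
  ... | tri< i<j _ _ = ⊥-elim (order-pow-distinct ord i<j j<m yⁱ≡yʲ)
  ... | tri≈ _ i≡j _ = i≡j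
  ... | tri> _ _ j<i = ⊥-elim (order-pow-distinct ord j<i i<m (sym yⁱ≡yʲ))

  -- For o(x) > 2 the inverse y = x^(o(x)-1) is a twin neighbour of x.
  order>2⇒twinNeighbour : ∀ {x m} → Order x m → 2 < m →
                          ∃ λ y → PowerAdj x y × (∀ {w} → w ≢ y → PowerAdj x w → PowerAdj y w)
  order>2⇒twinNeighbour {x} (_ , xᵐ≡ε , minimal) (s≤s (s≤s (s≤s {n = k} _))) =
    y , (x≢y , inj₁ x→y) , λ w≢y → mutualPowers-PowerAdj y→x x→y (w≢y ∘ sym)
    where
    t : ℕ
    t = suc (suc k)
    y : Fin n
    y = pow x t
    x→y : PositivePower x y
    x→y = t , s≤s z≤n , refl
    x≢y : x ≢ y
    x≢y x≡y = minimal (suc k) (s≤s z≤n) (s≤s (n≤1+n (suc k))) (x∙y≡x⇒y≡ε x (pow x (suc k)) (sym x≡y))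
    t²≡1+[t+1][t-1] : ∀ a → (2 + a) * (2 + a) ≡ 1 + (3 + a) * (1 + a)
    t²≡1+[t+1][t-1] = solve-∀
    y→x : PositivePower y x
    y→x = t , s≤s z≤n , sym (begin
      pow y t                   ≡⟨ pow-* x t t ⟩
      pow x (t * t)             ≡⟨ cong (pow x) (t²≡1+[t+1][t-1] k) ⟩
      x ∙ pow x (suc t * suc k) ≡⟨ cong (x ∙_) (pow≡ε⇒pow-*≡ε {x} {suc t} xᵐ≡ε (suc k)) ⟩
      x ∙ ε                     ≡⟨ identityʳ x ⟩
      x                         ∎)

  powers : Fin n → (m : ℕ) → List (Fin n)
  powers y m = tabulate {n = m} (pow y ∘ toℕ)

  powers-unique : ∀ {y m} → Order y m → Unique (powers y m)
  powers-unique ord = Unique.tabulate⁺ λ {i} {j} yⁱ≡yʲ →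
    toℕ-injective (order-injective ord (toℕ<n i) (toℕ<n j) yⁱ≡yʲ)

  InCyc⇒∈powers : ∀ {y m z} → Order y m → InCyc y z → z ∈ powers y m
  InCyc⇒∈powers {y} {m@(suc _)} {z} (s≤s z≤n , yᵐ≡ε , _) (k , z≡yᵏ) =
    subst (_∈ powers y m) (sym z≡yᵏ′) (∈-tabulate⁺ {f = pow y ∘ toℕ} (fromℕ< (m%n<n k m)))
    where
    z≡yᵏ′ : z ≡ pow y (toℕ (fromℕ< (m%n<n k m)))
    z≡yᵏ′ = trans z≡yᵏ (trans (pow-% y yᵐ≡ε k) (cong (pow y) (sym (toℕ-fromℕ< (m%n<n k m)))))

  ∈powers⇒InCyc : ∀ {y m z} → z ∈ powers y m → InCyc y z
  ∈powers⇒InCyc z∈powers with ∈-tabulate⁻ z∈powers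
  ... | i , z≡yⁱ = toℕ i , z≡yⁱ

  InCyc⇒PositivePower : ∀ {y m z} → Order y m → InCyc y z → PositivePower y z
  InCyc⇒PositivePower {m = m} (1≤m , yᵐ≡ε , _) (zero  , refl)  = m , 1≤m , sym yᵐ≡ε
  InCyc⇒PositivePower                        _ (suc k , z≡yᵏ) = suc k , s≤s z≤n , z≡yᵏ

  maximalCyclic-PowerAdj⇒InCyc : ∀ {y z} → MaximalCyclic y → PowerAdj y z → InCyc y z
  maximalCyclic-PowerAdj⇒InCyc _ (_ , inj₁ (k , _ , z≡yᵏ)) = k , z≡yᵏ
  maximalCyclic-PowerAdj⇒InCyc {y} {z} maximal (_ , inj₂ (j , _ , y≡zʲ)) =
    maximal z ⟨y⟩⊆⟨z⟩ z (1 , sym (identityʳ z))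
    where
    ⟨y⟩⊆⟨z⟩ : ∀ w → InCyc y w → InCyc z w
    ⟨y⟩⊆⟨z⟩ w (a , w≡yᵃ) = j * a , trans w≡yᵃ (trans (cong (λ s → pow s a) y≡zʲ) (pow-* z j a))

  -- The closed neighbourhood of a generator of a maximal cyclic subgroup is that subgroup.
  maximalCyclic-order≡1+degree : ∀ {y m d} → MaximalCyclic y → Order y m → Degree PowerAdj y d → m ≡ suc d
  maximalCyclic-order≡1+degree {y} {m} maximal ord (L , uniqueL , refl , L⇔) = begin
    m                   ≡⟨ length-tabulate (pow y ∘ toℕ) ⟨
    length (powers y m) ≡⟨ unique-⊆-⊇⇒length≡ (powers-unique ord) (y∉L ∷ uniqueL) powers⊆y∷L y∷L⊆powers ⟩
    length (y ∷ L)      ∎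
    where
    y∉L : All (y ≢_) L
    y∉L = All.tabulate λ z∈L → proj₁ (Equivalence.to (L⇔ _) z∈L)
    y∷L⊆powers : y ∷ L ⊆ powers y m
    y∷L⊆powers (here refl) = InCyc⇒∈powers ord (1 , sym (identityʳ y))
    y∷L⊆powers (there z∈L) =
      InCyc⇒∈powers ord (maximalCyclic-PowerAdj⇒InCyc maximal (Equivalence.to (L⇔ _) z∈L))
    powers⊆y∷L : powers y m ⊆ y ∷ L
    powers⊆y∷L {z} z∈powers with z ≟ᶠ y
    ... | yes refl = here refl
    ... | no z≢y   =
      there (Equivalence.from (L⇔ z) (z≢y ∘ sym , inj₁ (InCyc⇒PositivePower ord (∈powers⇒InCyc z∈powers))))

lemma3p1 : (G : FiniteGroup) → let open FiniteGroup G in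
    2 ≤ n →
    MinimallyEdgeConnected PowerAdj →
    (δ : ℕ) → MinDegree PowerAdj δ →
    ((x : Fin n) (m : ℕ) → Order x m → 2 < m → Degree PowerAdj x δ)
    × ((y : Fin n) (m : ℕ) → MaximalCyclic y → Order y m → 2 < m → m ≡ δ + 1)
lemma3p1 G _ minimal δ minDeg = degree≡δ , order≡δ+1
  where
  open FiniteGroup G
  open PowerGraph G

  degree≡δ : (x : Fin n) (m : ℕ) → Order x m → 2 < m → Degree PowerAdj x δ
  degree≡δ x m ord 2<m with order>2⇒twinNeighbour ord 2<m
  ... | _ , x~y , twin =
    twin-degree≡minDegree PowerAdj? PowerAdj-sym PowerAdj-irrefl minimal minDeg x~y twin

  order≡δ+1 : (y : Fin n) (m : ℕ) → MaximalCyclic y → Order y m → 2 < m → m ≡ δ + 1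
  order≡δ+1 y m maximal ord 2<m =
    trans (maximalCyclic-order≡1+degree maximal ord (degree≡δ y m ord 2<m)) (+-comm 1 δ)
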